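{- Let ${\cal F}$ be a Fano plane, $\epsilon$ a composition factor and $g\in\mathrm{Aut}({\cal F})$. (1) Let $L$ be a line and let $L_1,\dots,L_6$ be the six other lines, labelled so that $L=\{L_1\cap L_2,\ L_3\cap L_4,\ L_5\cap L_6\}$ (such a partition into pairs is unique). Then $\delta^\ast(g,L_1)\delta^\ast(g,L_2)=\delta^\ast(g,L_3)\delta^\ast(g,L_4)=\delta^\ast(g,L_5)\delta^\ast(g,L_6)$. (2) Let $P,P'$ be points, let $D_1,D_2,D_3$ be the three lines through $P$ and $D'_1,D'_2,D'_3$ the three lines through $P'$. Then $\delta^\ast(g,D_1)\delta^\ast(g,D_2)\delta^\ast(g,D_3)=\delta^\ast(g,D'_1)\delta^\ast(g,D'_2)\delta^\ast(g,D'_3)$.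
   Context: ${\cal F}$ is a Fano plane (seven points, seven lines), $\mathrm{Aut}({\cal F})$ the group of bijections sending lines to lines; for distinct $P,Q$, $P+Q$ is the third point on their line. $\mathbb F$ is a field of characteristic not 2, $\mathbb O_{\cal F}$ has basis $1,e_P$. A multiplication factor $\epsilon$ assigns $\epsilon_{PQ}\in\{\pm1\}$ to distinct $P,Q$ with $\epsilon_{QP}=-\epsilon_{PQ}$, defining the product with unit $1$, $e_Pe_Q=\epsilon_{PQ}e_{P+Q}$, $e_P^2=-1$; it is a composition factor if $N(\lambda^01+\sum\lambda^Pe_P)=(\lambda^0)^2+\sum(\lambda^P)^2$ is multiplicative. For a line $D$, $\delta^\ast(g,D)=\epsilon_{AB}\epsilon_{g(A)g(B)}$ for any distinct $A,B\in D$ (independent of the choice). -}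

module Defs where

open import Level using (Level; _⊔_; suc; 0ℓ)
open import Data.Nat using (ℕ)
open import Data.Fin using (Fin; _≟_)
import Data.Fin as Fin
open import Data.Fin.Subset.Properties using (_∈?_)
open import Data.Fin.Subset using (Subset; _∈_; ⁅_⁆; _∪_; ∣_∣)
open import Data.Fin.Permutation using (Permutation′; _⟨$⟩ʳ_; _⟨$⟩ˡ_)
open import Data.Vec using (tabulate; lookup)
open import Data.List using (List; []; _∷_; filter; allFin)
open import Data.Product using (Σ; ∃; _×_; _,_; proj₁)
open import Data.Sign using (Sign; opposite) renaming (_*_ to _·ₛ_)
import Data.Sign as S
open import Relation.Nullary using (¬_; Dec; yes; no)
open import Relation.Unary using (Pred; Decidable)
open import Relation.Binary.PropositionalEquality using (_≡_; _≢_)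
open import Algebra.Bundles using (CommutativeRing)

record Field (c ℓ : Level) : Set (suc (c ⊔ ℓ)) where
  field
    commutativeRing : CommutativeRing c ℓ
  open CommutativeRing commutativeRing public
  field
    0≉1     : ¬ (0# ≈ 1#)
    inverse : ∀ x → ¬ (x ≈ 0#) → Σ Carrier λ y → x * y ≈ 1#

CharNot2 : ∀ {c ℓ} → Field c ℓ → Set ℓ
CharNot2 F = ¬ (1# + 1# ≈ 0#) where open Field F

Point : Set
Point = Fin 7

record FanoPlane : Set₁ where
  field
    IsLine    : Pred (Subset 7) 0ℓ
    isLine?   : Decidable IsLine
    line-size : ∀ L → IsLine L → ∣ L ∣ ≡ 3
    line-exists : ∀ (P Q : Point) → P ≢ Q →
                  Σ (Subset 7) λ L → IsLine L × P ∈ L × Q ∈ L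
    line-unique : ∀ (P Q : Point) → P ≢ Q → ∀ L L′ →
                  IsLine L → P ∈ L → Q ∈ L →
                  IsLine L′ → P ∈ L′ → Q ∈ L′ → L ≡ L′
  -- the number of lines (seven) is a consequence of these axioms

module _ (𝓕 : FanoPlane) where
  open FanoPlane 𝓕

  IsSum : Point → Point → Point → Set
  IsSum P Q R = P ≢ Q × P ≢ R × Q ≢ R × IsLine (⁅ P ⁆ ∪ ⁅ Q ⁆ ∪ ⁅ R ⁆)

  isSum? : ∀ P Q R → Dec (IsSum P Q R)
  isSum? P Q R with P ≟ Q | P ≟ R | Q ≟ R | isLine? (⁅ P ⁆ ∪ ⁅ Q ⁆ ∪ ⁅ R ⁆)
  ... | yes p | _ | _ | _ = no λ (a , _) → a p
  ... | no a | yes p | _ | _ = no λ (_ , b , _) → b p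
  ... | no a | no b | yes p | _ = no λ (_ , _ , c , _) → c p
  ... | no a | no b | no c | no d = no λ (_ , _ , _ , e) → d e
  ... | no a | no b | no c | yes d = yes (a , b , c , d)

  image : Permutation′ 7 → Subset 7 → Subset 7
  image g S = tabulate λ j → lookup S (g ⟨$⟩ˡ j)

  IsAut : Permutation′ 7 → Set
  IsAut g = ∀ L → IsLine L → IsLine (image g L)

  MulFactor : Set
  MulFactor = Point → Point → Sign

  IsMulFactor : MulFactor → Set
  IsMulFactor ε = ∀ P Q → P ≢ Q → ε Q P ≡ opposite (ε P Q)

  -- the algebra 𝕆_𝓕 over a field, elements λ⁰ 1 + Σ λᴾ e_P
  module Alg {c ℓ} (F : Field c ℓ) where
    open Field F

    sum : ∀ {n} → (Fin n → Carrier) → Carrier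
    sum {ℕ.zero}  f = 0#
    sum {ℕ.suc n} f = f Fin.zero + sum (λ i → f (Fin.suc i))

    Oct : Set c
    Oct = Carrier × (Point → Carrier)

    sgn : Sign → Carrier
    sgn S.+ = 1#
    sgn S.- = - 1#

    -- the product: unit 1, e_P e_Q = ε_PQ e_{P+Q}, e_P² = -1
    mul : MulFactor → Oct → Oct → Oct
    mul ε (a⁰ , a) (b⁰ , b) =
        (a⁰ * b⁰ - sum (λ P → a P * b P))
      , λ R → a⁰ * b R + a R * b⁰
              + sum (λ P → sum (λ Q → coeff P Q R))
      where
      coeff : Point → Point → Point → Carrier
      coeff P Q R with isSum? P Q R
      ... | yes _ = sgn (ε P Q) * (a P * b Q)
      ... | no  _ = 0#

    N : Oct → Carrier
    N (a⁰ , a) = a⁰ * a⁰ + sum (λ P → a P * a P)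

    IsCompositionFactor : MulFactor → Set (c ⊔ ℓ)
    IsCompositionFactor ε = ∀ x y → N (mul ε x y) ≈ N x * N y

  -- δ*(g, D) = ε_AB ε_{g(A) g(B)} for distinct A, B ∈ D; we take A, B to
  -- be the two smallest points of D (the value is independent of this
  -- choice).

  pointsOf : Subset 7 → List Point
  pointsOf D = filter (_∈? D) (allFin 7)

  δ* : MulFactor → Permutation′ 7 → Subset 7 → Sign
  δ* ε g D with pointsOf D
  ... | A ∷ B ∷ _ = ε A B ·ₛ ε (g ⟨$⟩ʳ A) (g ⟨$⟩ʳ B)
  ... | _ = S.+

-- Norm multiplicativity, tested on (1 + e_A)(e_B + e_C) and on (e_A + e_B)(e_C + e_D), forces two
-- sign rules on ε: ε is cyclic on every line (ε_AB = ε_BC = ε_CA), and ε_AC ε_BD = -ε_AD ε_BC for every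
-- quadrangle a, b, c, d whose diagonal points T = ac ∩ bd and U = ad ∩ bc are distinct.  An automorphism
-- preserves both rules, so δ*(g, D) = ε_AB ε_{g(A)g(B)} does not depend on the choice of A, B ∈ D, and
-- δ*(ac) δ*(bd) = δ*(ad) δ*(bc) for the four sides of such a quadrangle.  Given P ≠ R and a point a off
-- the line M = PR, the points c = P + a, d = R + a, b = R + c form a quadrangle with diagonal points P and
-- R; its sides and M are the three lines through P and the three lines through R, so the products of δ*
-- over the pencils of P and of R agree, which is (2).  In (1), each pair L_{2i-1}, L_{2i} meets on L, the
-- pencil of that point is {L, L_{2i-1}, L_{2i}}, and (2) with δ*(L) cancelled gives (1).

module Submission where

open import Data.Bool using (true; false)
import Data.Bool as Bool
open import Data.Empty using (⊥; ⊥-elim)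
open import Data.Fin using (Fin; suc; _≟_; #_; punchIn)
open import Data.Fin.Permutation using (Permutation′; _⟨$⟩ʳ_; _⟨$⟩ˡ_; inverseˡ; inverseʳ)
open import Data.Fin.Properties using (<⇒notInjective; punchInᵢ≢i)
open import Data.Fin.Subset using (Subset; _∈_; _∉_; _⊆_; _∩_; _∪_; ⁅_⁆; ∣_∣; inside; outside)
open import Data.Fin.Subset.Properties
  using (_∈?_; x∈⁅x⁆; x∈⁅y⁆⇒x≡y; x∈p∪q⁺; x∈p∪q⁻; x∈p∩q⁻; p∩q⊆p; ⊆-antisym; ∪-comm; ∪-assoc)
open import Data.List using (List; []; _∷_; length; filter; allFin; map; tabulate; foldr)
open import Data.List.Properties using (map-tabulate; length-map)
open import Data.List.Membership.Propositional using () renaming (_∈_ to _∈ₗ_)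
open import Data.List.Membership.Propositional.Properties using (∈-filter⁺; ∈-filter⁻; ∈-allFin; ∈-map⁺; ∈-map⁻)
open import Data.List.Membership.Propositional.Properties.WithK using (unique∧set⇒bag)
open import Data.List.Relation.Binary.BagAndSetEquality using (∼bag⇒↭)
open import Data.List.Relation.Binary.Permutation.Propositional using (_↭_; ↭⇒↭ₛ)
open import Data.List.Relation.Binary.Permutation.Propositional.Properties using (map⁺)
open import Data.List.Relation.Binary.Permutation.Setoid.Properties using (foldr-commMonoid)
open import Data.List.Relation.Unary.All using (All; []; _∷_)
import Data.List.Relation.Unary.All as All
open import Data.List.Relation.Unary.AllPairs using ([]; _∷_)
open import Data.List.Relation.Unary.Any using (here; there)
open import Data.List.Relation.Unary.Unique.Propositional using (Unique)
import Data.List.Relation.Unary.Unique.Propositional.Properties as Unique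
open import Data.Nat using (ℕ)
open import Data.Nat.Properties using (n<1+n)
open import Data.Product using (Σ-syntax; ∃; _×_; _,_; proj₁; proj₂)
open import Data.Sign using (Sign; opposite) renaming (_*_ to _·_)
open import Data.Sum using (_⊎_; inj₁; inj₂)
import Data.Sum as Sum
open import Data.Vec using (Vec; []; _∷_; lookup)
open import Data.Vec.Properties using (lookup∘tabulate; []=⇒lookup; lookup⇒[]=; ≡-dec)
open import Data.Vec.Relation.Unary.All using ([]; _∷_)
open import Data.Vec.Relation.Unary.AllPairs using ([]; _∷_)
open import Data.Vec.Relation.Unary.Unique.Propositional using () renaming (Unique to VecUnique)
open import Data.Vec.Relation.Unary.Unique.Propositional.Properties using (lookup-injective)
open import Defs
open import Function using (_∘_; id)
open import Function.Bundles using (mk⇔)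
open import Relation.Binary.PropositionalEquality
  using (_≡_; _≢_; refl; sym; trans; cong; cong₂; subst; module ≡-Reasoning)
import Relation.Binary.PropositionalEquality as ≡
open import Relation.Nullary using (¬_; yes; no; does)

opposite-·-opposite : ∀ s t → opposite s · opposite t ≡ s · t
opposite-·-opposite Sign.+ Sign.+ = refl
opposite-·-opposite Sign.+ Sign.- = refl
opposite-·-opposite Sign.- Sign.+ = refl
opposite-·-opposite Sign.- Sign.- = refl

same-or-opposite : ∀ s s′ → s′ ≡ s ⊎ s′ ≡ opposite s
same-or-opposite Sign.+ Sign.+ = inj₁ refl
same-or-opposite Sign.+ Sign.- = inj₂ refl
same-or-opposite Sign.- Sign.+ = inj₂ refl
same-or-opposite Sign.- Sign.- = inj₁ refl

triple : Point → Point → Point → Subset 7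
triple P Q R = ⁅ P ⁆ ∪ ⁅ Q ⁆ ∪ ⁅ R ⁆

module _ {P Q R : Point} where

  ∈-triple⁻ : ∀ {X} → X ∈ triple P Q R → X ∈ₗ P ∷ Q ∷ R ∷ []
  ∈-triple⁻ X∈ with x∈p∪q⁻ ⁅ P ⁆ _ X∈
  ... | inj₁ X∈P = here (x∈⁅y⁆⇒x≡y P X∈P)
  ... | inj₂ X∈QR with x∈p∪q⁻ ⁅ Q ⁆ _ X∈QR
  ...   | inj₁ X∈Q = there (here (x∈⁅y⁆⇒x≡y Q X∈Q))
  ...   | inj₂ X∈R = there (there (here (x∈⁅y⁆⇒x≡y R X∈R)))

  ∈-triple⁺ : ∀ {X} → X ∈ₗ P ∷ Q ∷ R ∷ [] → X ∈ triple P Q R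
  ∈-triple⁺ (here refl)                 = x∈p∪q⁺ (inj₁ (x∈⁅x⁆ P))
  ∈-triple⁺ (there (here refl))         = x∈p∪q⁺ (inj₂ (x∈p∪q⁺ (inj₁ (x∈⁅x⁆ Q))))
  ∈-triple⁺ (there (there (here refl))) = x∈p∪q⁺ (inj₂ (x∈p∪q⁺ (inj₂ (x∈⁅x⁆ R))))

  ∈-triple₁ : P ∈ triple P Q R
  ∈-triple₁ = ∈-triple⁺ (here refl)

  ∈-triple₂ : Q ∈ triple P Q R
  ∈-triple₂ = ∈-triple⁺ (there (here refl))

  ∈-triple₃ : R ∈ triple P Q R
  ∈-triple₃ = ∈-triple⁺ (there (there (here refl)))

triple-swap₁₂ : ∀ P Q R → triple P Q R ≡ triple Q P R
triple-swap₁₂ P Q R = trans (sym (∪-assoc ⁅ P ⁆ ⁅ Q ⁆ ⁅ R ⁆))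
  (trans (cong (_∪ ⁅ R ⁆) (∪-comm ⁅ P ⁆ ⁅ Q ⁆)) (∪-assoc ⁅ Q ⁆ ⁅ P ⁆ ⁅ R ⁆))

triple-swap₂₃ : ∀ P Q R → triple P Q R ≡ triple P R Q
triple-swap₂₃ P Q R = cong (⁅ P ⁆ ∪_) (∪-comm ⁅ Q ⁆ ⁅ R ⁆)

members : ∀ {n} → Subset n → List (Fin n)
members {n} S = filter (_∈? S) (allFin n)

members-∷ : ∀ {n} s (S : Subset n) xs →
            filter (_∈? (s ∷ S)) (map suc xs) ≡ map suc (filter (_∈? S) xs)
members-∷ s S []       = refl
members-∷ s S (x ∷ xs) with does (x ∈? S)
... | true  = cong (suc x ∷_) (members-∷ s S xs)
... | false = members-∷ s S xs

length-members-suc : ∀ {n} s (S : Subset n) →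
                     length (filter (_∈? (s ∷ S)) (tabulate (suc {n}))) ≡ length (members S)
length-members-suc {n} s S = begin
  length (filter (_∈? (s ∷ S)) (tabulate suc))        ≡⟨ cong (length ∘ filter (_∈? (s ∷ S))) (sym (map-tabulate id suc)) ⟩
  length (filter (_∈? (s ∷ S)) (map suc (allFin n)))  ≡⟨ cong length (members-∷ s S (allFin n)) ⟩
  length (map suc (members S))                        ≡⟨ length-map suc (members S) ⟩
  length (members S)                                  ∎
  where open ≡-Reasoning

length-members : ∀ {n} (S : Subset n) → length (members S) ≡ ∣ S ∣
length-members []            = refl
length-members (inside ∷ S)  = cong ℕ.suc (trans (length-members-suc inside S) (length-members S))
length-members (outside ∷ S) = trans (length-members-suc outside S) (length-members S)

∈-members⁺ : ∀ {n} {S : Subset n} {x} → x ∈ S → x ∈ₗ members S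
∈-members⁺ {S = S} {x} x∈S = ∈-filter⁺ (_∈? S) (∈-allFin x) x∈S

∈-members⁻ : ∀ {n} {S : Subset n} {x} → x ∈ₗ members S → x ∈ S
∈-members⁻ {n} {S} x∈ = proj₂ (∈-filter⁻ (_∈? S) {xs = allFin n} x∈)

members-unique : ∀ {n} (S : Subset n) → Unique (members S)
members-unique {n} S = Unique.filter⁺ (_∈? S) (Unique.allFin⁺ n)

pigeonhole-unique : ∀ {n} {xs : Vec (Fin n) (ℕ.suc n)} → ¬ VecUnique xs
pigeonhole-unique {n} u = <⇒notInjective (n<1+n n) (λ {i} {j} → lookup-injective u i j)

module Geometry (𝓕 : FanoPlane) where
  open FanoPlane 𝓕

  private variable
    P Q R X Y : Point
    L L′ : Subset 7

  sum-line : IsSum 𝓕 P Q R → IsLine (triple P Q R)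
  sum-line (_ , _ , _ , line) = line

  sum-≢₁₂ : IsSum 𝓕 P Q R → P ≢ Q
  sum-≢₁₂ (P≢Q , _ , _ , _) = P≢Q

  sum-≢₁₃ : IsSum 𝓕 P Q R → P ≢ R
  sum-≢₁₃ (_ , P≢R , _ , _) = P≢R

  sum-≢₂₃ : IsSum 𝓕 P Q R → Q ≢ R
  sum-≢₂₃ (_ , _ , Q≢R , _) = Q≢R

  sum-swap₁₂ : IsSum 𝓕 P Q R → IsSum 𝓕 Q P R
  sum-swap₁₂ {P} {Q} {R} (P≢Q , P≢R , Q≢R , line) =
    P≢Q ∘ sym , Q≢R , P≢R , subst IsLine (triple-swap₁₂ P Q R) line

  sum-swap₂₃ : IsSum 𝓕 P Q R → IsSum 𝓕 P R Q
  sum-swap₂₃ {P} {Q} {R} (P≢Q , P≢R , Q≢R , line) =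
    P≢R , P≢Q , Q≢R ∘ sym , subst IsLine (triple-swap₂₃ P Q R) line

  sum-rotate : IsSum 𝓕 P Q R → IsSum 𝓕 Q R P
  sum-rotate = sum-swap₂₃ ∘ sum-swap₁₂

  same-line : IsLine L → IsLine L′ → X ≢ Y → X ∈ L → Y ∈ L → X ∈ L′ → Y ∈ L′ → L ≡ L′
  same-line {L} {L′} {X} {Y} l l′ X≢Y X∈L Y∈L X∈L′ Y∈L′ = line-unique X Y X≢Y L L′ l X∈L Y∈L l′ X∈L′ Y∈L′

  line-triple : IsLine L → Σ[ X ∈ Point ] Σ[ Y ∈ Point ] Σ[ Z ∈ Point ]
                IsSum 𝓕 X Y Z × L ≡ triple X Y Z × pointsOf 𝓕 L ≡ X ∷ Y ∷ Z ∷ []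
  line-triple {L} l with members L | members-unique L | trans (length-members L) (line-size L l)
                        | ∈-members⁺ {S = L} | ∈-members⁻ {S = L}
  ... | X ∷ Y ∷ Z ∷ [] | (X≢Y ∷ X≢Z ∷ []) ∷ (Y≢Z ∷ []) ∷ [] ∷ [] | refl | to | from =
    X , Y , Z , (X≢Y , X≢Z , Y≢Z , subst IsLine L≡XYZ l) , L≡XYZ , refl
    where
    L≡XYZ : L ≡ triple X Y Z
    L≡XYZ = ⊆-antisym (∈-triple⁺ ∘ to) (from ∘ ∈-triple⁻)

  line-through : IsLine L → P ∈ L → Σ[ Q ∈ Point ] Σ[ R ∈ Point ] IsSum 𝓕 P Q R × L ≡ triple P Q R
  line-through l P∈L with line-triple l
  ... | X , Y , Z , s , refl , _ with ∈-triple⁻ P∈L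
  ...   | here refl                 = Y , Z , s , refl
  ...   | there (here refl)         = X , Z , sum-swap₁₂ s , triple-swap₁₂ X Y Z
  ...   | there (there (here refl)) = X , Y , sum-rotate (sum-rotate s) ,
                                      trans (triple-swap₂₃ X Y Z) (triple-swap₁₂ X Z Y)

  sum-exists : P ≢ Q → ∃ (IsSum 𝓕 P Q)
  sum-exists {P} {Q} P≢Q with line-exists P Q P≢Q
  ... | L , l , P∈L , Q∈L with line-through l P∈L
  ...   | Q′ , R′ , s , refl with ∈-triple⁻ Q∈L
  ...     | here refl                 = ⊥-elim (P≢Q refl)
  ...     | there (here refl)         = R′ , s
  ...     | there (there (here refl)) = Q′ , sum-swap₂₃ s

  sum-unique : ∀ {R′} → IsSum 𝓕 P Q R → IsSum 𝓕 P Q R′ → R ≡ R′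
  sum-unique {P} {Q} {R} {R′} (P≢Q , _ , _ , l) (_ , P≢R′ , Q≢R′ , l′)
    with ∈-triple⁻ (subst (R′ ∈_) (same-line l′ l P≢Q ∈-triple₁ ∈-triple₂ ∈-triple₁ ∈-triple₂) ∈-triple₃)
  ... | here refl                 = ⊥-elim (P≢R′ refl)
  ... | there (here refl)         = ⊥-elim (Q≢R′ refl)
  ... | there (there (here refl)) = refl

  record Pencil (P : Point) (D₁ D₂ D₃ : Subset 7) : Set where
    constructor pencil
    field
      lines    : All IsLine (D₁ ∷ D₂ ∷ D₃ ∷ [])
      distinct : Unique (D₁ ∷ D₂ ∷ D₃ ∷ [])
      through  : All (P ∈_) (D₁ ∷ D₂ ∷ D₃ ∷ [])

  pencil-covers : ∀ {D₁ D₂ D₃} → Pencil P D₁ D₂ D₃ → ∀ Z → Z ∈ D₁ ⊎ Z ∈ D₂ ⊎ Z ∈ D₃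
  pencil-covers {P} {D₁} {D₂} {D₃} (pencil (l₁ ∷ l₂ ∷ l₃ ∷ []) ((D₁≢D₂ ∷ D₁≢D₃ ∷ []) ∷ (D₂≢D₃ ∷ []) ∷ [] ∷ [])
                                           (P∈D₁ ∷ P∈D₂ ∷ P∈D₃ ∷ [])) Z
    with Z ∈? D₁ | Z ∈? D₂ | Z ∈? D₃
  ... | yes Z∈D₁ | _        | _        = inj₁ Z∈D₁
  ... | no _     | yes Z∈D₂ | _        = inj₂ (inj₁ Z∈D₂)
  ... | no _     | no _     | yes Z∈D₃ = inj₂ (inj₂ Z∈D₃)
  ... | no Z∉D₁  | no Z∉D₂  | no Z∉D₃
    -- then Z, P and the two further points of each Dᵢ would be eight distinct points
    with line-through l₁ P∈D₁ | line-through l₂ P∈D₂ | line-through l₃ P∈D₃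
  ... | x₁ , y₁ , (P≢x₁ , P≢y₁ , x₁≢y₁ , _) , refl | x₂ , y₂ , (P≢x₂ , P≢y₂ , x₂≢y₂ , _) , refl
      | x₃ , y₃ , (P≢x₃ , P≢y₃ , x₃≢y₃ , _) , refl = ⊥-elim (pigeonhole-unique eight)
    where
    apart : ∀ {D w} → w ∈ D → Z ∉ D → Z ≢ w
    apart w∈D Z∉D refl = Z∉D w∈D

    across : ∀ {D D′ u v} → IsLine D → IsLine D′ → P ∈ D → P ∈ D′ → D ≢ D′ → P ≢ u → u ∈ D → v ∈ D′ → u ≢ v
    across l l′ P∈D P∈D′ D≢D′ P≢u u∈D v∈D′ refl = D≢D′ (same-line l l′ P≢u P∈D u∈D P∈D′ v∈D′)

    eight : VecUnique (Z ∷ P ∷ x₁ ∷ y₁ ∷ x₂ ∷ y₂ ∷ x₃ ∷ y₃ ∷ [])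
    eight = (apart ∈-triple₁ Z∉D₁ ∷ apart ∈-triple₂ Z∉D₁ ∷ apart ∈-triple₃ Z∉D₁ ∷ apart ∈-triple₂ Z∉D₂ ∷
             apart ∈-triple₃ Z∉D₂ ∷ apart ∈-triple₂ Z∉D₃ ∷ apart ∈-triple₃ Z∉D₃ ∷ [])
          ∷ (P≢x₁ ∷ P≢y₁ ∷ P≢x₂ ∷ P≢y₂ ∷ P≢x₃ ∷ P≢y₃ ∷ [])
          ∷ (x₁≢y₁ ∷ a₁₂ P≢x₁ ∈-triple₂ ∈-triple₂ ∷ a₁₂ P≢x₁ ∈-triple₂ ∈-triple₃ ∷
                     a₁₃ P≢x₁ ∈-triple₂ ∈-triple₂ ∷ a₁₃ P≢x₁ ∈-triple₂ ∈-triple₃ ∷ [])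
          ∷ (a₁₂ P≢y₁ ∈-triple₃ ∈-triple₂ ∷ a₁₂ P≢y₁ ∈-triple₃ ∈-triple₃ ∷
             a₁₃ P≢y₁ ∈-triple₃ ∈-triple₂ ∷ a₁₃ P≢y₁ ∈-triple₃ ∈-triple₃ ∷ [])
          ∷ (x₂≢y₂ ∷ a₂₃ P≢x₂ ∈-triple₂ ∈-triple₂ ∷ a₂₃ P≢x₂ ∈-triple₂ ∈-triple₃ ∷ [])
          ∷ (a₂₃ P≢y₂ ∈-triple₃ ∈-triple₂ ∷ a₂₃ P≢y₂ ∈-triple₃ ∈-triple₃ ∷ [])
          ∷ (x₃≢y₃ ∷ [])
          ∷ []
          ∷ []
      where
      a₁₂ : ∀ {u v} → P ≢ u → u ∈ triple P x₁ y₁ → v ∈ triple P x₂ y₂ → u ≢ v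
      a₁₂ = across l₁ l₂ ∈-triple₁ ∈-triple₁ D₁≢D₂
      a₁₃ : ∀ {u v} → P ≢ u → u ∈ triple P x₁ y₁ → v ∈ triple P x₃ y₃ → u ≢ v
      a₁₃ = across l₁ l₃ ∈-triple₁ ∈-triple₁ D₁≢D₃
      a₂₃ : ∀ {u v} → P ≢ u → u ∈ triple P x₂ y₂ → v ∈ triple P x₃ y₃ → u ≢ v
      a₂₃ = across l₂ l₃ ∈-triple₁ ∈-triple₁ D₂≢D₃

  pencil-complete : ∀ {D₁ D₂ D₃ M} → Pencil P D₁ D₂ D₃ → IsLine M → P ∈ M → M ∈ₗ D₁ ∷ D₂ ∷ D₃ ∷ []
  pencil-complete p@(pencil (l₁ ∷ l₂ ∷ l₃ ∷ []) _ (P∈D₁ ∷ P∈D₂ ∷ P∈D₃ ∷ [])) m P∈M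
    with line-through m P∈M
  ... | Q , _ , (P≢Q , _) , refl with pencil-covers p Q
  ...   | inj₁ Q∈D₁        = here (same-line m l₁ P≢Q ∈-triple₁ ∈-triple₂ P∈D₁ Q∈D₁)
  ...   | inj₂ (inj₁ Q∈D₂) = there (here (same-line m l₂ P≢Q ∈-triple₁ ∈-triple₂ P∈D₂ Q∈D₂))
  ...   | inj₂ (inj₂ Q∈D₃) = there (there (here (same-line m l₃ P≢Q ∈-triple₁ ∈-triple₂ P∈D₃ Q∈D₃)))

  pencil-↭ : ∀ {D₁ D₂ D₃ E₁ E₂ E₃} → Pencil P D₁ D₂ D₃ → Pencil P E₁ E₂ E₃ →
             D₁ ∷ D₂ ∷ D₃ ∷ [] ↭ E₁ ∷ E₂ ∷ E₃ ∷ []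
  pencil-↭ p q = ∼bag⇒↭ (unique∧set⇒bag (Pencil.distinct p) (Pencil.distinct q) (mk⇔ (into p q) (into q p)))
    where
    into : ∀ {D₁ D₂ D₃ E₁ E₂ E₃ M} → Pencil P D₁ D₂ D₃ → Pencil P E₁ E₂ E₃ →
           M ∈ₗ D₁ ∷ D₂ ∷ D₃ ∷ [] → M ∈ₗ E₁ ∷ E₂ ∷ E₃ ∷ []
    into p q M∈ = pencil-complete q (All.lookup (Pencil.lines p) M∈) (All.lookup (Pencil.through p) M∈)

  ∉⇒≢ : X ∉ L → Y ∈ L → X ≢ Y
  ∉⇒≢ X∉L Y∈L refl = X∉L Y∈L

  ∉⇒line≢ : X ∉ L → X ∈ L′ → L ≢ L′
  ∉⇒line≢ X∉L X∈L′ refl = X∉L X∈L′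

  ∉-same-line : ∀ {A} → IsLine L → IsLine L′ → X ≢ Y → X ∈ L → Y ∈ L → X ∈ L′ → Y ∈ L′ → A ∈ L → A ∉ L′ → ⊥
  ∉-same-line l l′ X≢Y X∈L Y∈L X∈L′ Y∈L′ A∈L A∉L′ = ∉⇒line≢ A∉L′ A∈L (sym (same-line l l′ X≢Y X∈L Y∈L X∈L′ Y∈L′))

  -- a, b, c, d is a quadrangle with diagonal points P = ac ∩ bd and R = ad ∩ bc; the pencil of P (of R)
  -- consists of the line M = PR and the two sides through P (through R)
  record Quadrangle (P R : Point) (M : Subset 7) : Set where
    field
      a b c d  : Point
      ac-P     : IsSum 𝓕 a c P
      bd-P     : IsSum 𝓕 b d P
      ad-R     : IsSum 𝓕 a d R
      bc-R     : IsSum 𝓕 b c R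
      pencil-P : Pencil P M (triple a c P) (triple b d P)
      pencil-R : Pencil R M (triple a d R) (triple b c R)

  module _ {P R V a c d} (PRV : IsSum 𝓕 P R V) (a∉M : a ∉ triple P R V)
           (Pac : IsSum 𝓕 P a c) (Rad : IsSum 𝓕 R a d) where
    private
      M : Subset 7
      M = triple P R V

      m : IsLine M
      m = sum-line PRV

      ac-P : IsSum 𝓕 a c P
      ac-P = sum-rotate Pac

      ad-R : IsSum 𝓕 a d R
      ad-R = sum-rotate Rad

      c∉M : c ∉ M
      c∉M c∈M = ∉-same-line (sum-line ac-P) m (sum-≢₂₃ ac-P ∘ sym) ∈-triple₃ ∈-triple₂ ∈-triple₁ c∈M ∈-triple₁ a∉M

      d∉M : d ∉ M
      d∉M d∈M = ∉-same-line (sum-line ad-R) m (sum-≢₂₃ ad-R ∘ sym) ∈-triple₃ ∈-triple₂ ∈-triple₂ d∈M ∈-triple₁ a∉M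

    R∉ac : R ∉ triple a c P
    R∉ac R∈ = ∉-same-line (sum-line ac-P) m (sum-≢₁₂ PRV) ∈-triple₃ R∈ ∈-triple₁ ∈-triple₂ ∈-triple₁ a∉M

    private
      d∉ac : d ∉ triple a c P
      d∉ac d∈ = ∉-same-line (sum-line ad-R) (sum-line ac-P) (sum-≢₁₂ ad-R) ∈-triple₁ ∈-triple₂ ∈-triple₁ d∈ ∈-triple₃ R∉ac

      c∉ad : c ∉ triple a d R
      c∉ad c∈ = ∉-same-line (sum-line ad-R) (sum-line ac-P) (sum-≢₁₂ ac-P) ∈-triple₁ c∈ ∈-triple₁ ∈-triple₂ ∈-triple₃ R∉ac

    module _ {b} (Rcb : IsSum 𝓕 R c b) where
      private
        bc-R : IsSum 𝓕 b c R
        bc-R = sum-swap₁₂ (sum-rotate Rcb)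

        b∉M : b ∉ M
        b∉M b∈M = ∉-same-line (sum-line bc-R) m (sum-≢₁₃ bc-R ∘ sym) ∈-triple₃ ∈-triple₁ ∈-triple₂ b∈M ∈-triple₂ c∉M

        -- b lies on one of the three lines through P, and the only possible one is P d (P + d)
        bd-P : IsSum 𝓕 b d P
        bd-P with sum-exists (∉⇒≢ d∉M ∈-triple₁ ∘ sym)
        ... | y , Pdy with pencil-covers (pencil (m ∷ sum-line ac-P ∷ sum-line Pdy ∷ [])
                                                 ((∉⇒line≢ a∉M ∈-triple₁ ∷ ∉⇒line≢ d∉M ∈-triple₂ ∷ []) ∷
                                                  (∉⇒line≢ d∉ac ∈-triple₂ ∷ []) ∷ [] ∷ [])
                                                 (∈-triple₁ ∷ ∈-triple₃ ∷ ∈-triple₁ ∷ [])) b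
        ...   | inj₁ b∈M  = ⊥-elim (b∉M b∈M)
        ...   | inj₂ (inj₁ b∈ac) = ⊥-elim (∉-same-line (sum-line bc-R) (sum-line ac-P) (sum-≢₁₂ bc-R ∘ sym)
                                                   ∈-triple₂ ∈-triple₁ ∈-triple₂ b∈ac ∈-triple₃ R∉ac)
        ...   | inj₂ (inj₂ b∈Pdy) with ∈-triple⁻ b∈Pdy
        ...     | here refl = ⊥-elim (b∉M ∈-triple₁)
        ...     | there (here refl) = ⊥-elim (∉-same-line (sum-line bc-R) (sum-line ad-R) (sum-≢₂₃ ad-R ∘ sym)
                                                     ∈-triple₃ ∈-triple₁ ∈-triple₃ ∈-triple₂ ∈-triple₂ c∉ad)
        ...     | there (there (here refl)) = sum-swap₁₂ (sum-rotate Pdy)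

      quadrangle-from : Quadrangle P R M
      quadrangle-from = record
        { a = a ; b = b ; c = c ; d = d ; ac-P = ac-P ; bd-P = bd-P ; ad-R = ad-R ; bc-R = bc-R
        ; pencil-P = pencil (m ∷ sum-line ac-P ∷ sum-line bd-P ∷ [])
                            ((∉⇒line≢ a∉M ∈-triple₁ ∷ ∉⇒line≢ d∉M ∈-triple₂ ∷ []) ∷ (∉⇒line≢ d∉ac ∈-triple₂ ∷ []) ∷ [] ∷ [])
                            (∈-triple₁ ∷ ∈-triple₃ ∷ ∈-triple₃ ∷ [])
        ; pencil-R = pencil (m ∷ sum-line ad-R ∷ sum-line bc-R ∷ [])
                            ((∉⇒line≢ a∉M ∈-triple₁ ∷ ∉⇒line≢ c∉M ∈-triple₂ ∷ []) ∷ (∉⇒line≢ c∉ad ∈-triple₂ ∷ []) ∷ [] ∷ [])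
                            (∈-triple₂ ∷ ∈-triple₃ ∷ ∈-triple₃ ∷ [])
        }

  quadrangle : ∀ {V a} → IsSum 𝓕 P R V → a ∉ triple P R V → Quadrangle P R (triple P R V)
  quadrangle PRV a∉M with sum-exists (∉⇒≢ a∉M ∈-triple₁ ∘ sym) | sum-exists (∉⇒≢ a∉M ∈-triple₂ ∘ sym)
  ... | c , Pac | d , Rad with sum-exists (∉⇒≢ (R∉ac PRV a∉M Pac Rad) ∈-triple₂)
  ...   | b , Rcb = quadrangle-from PRV a∉M Pac Rad Rcb

  point-off : ∀ {D M} → IsLine D → IsLine M → P ∈ D → P ∈ M → D ≢ M → ∃ (_∉ M)
  point-off d m P∈D P∈M D≢M with line-through d P∈D
  ... | x , _ , (P≢x , _) , refl = x , λ x∈M → D≢M (same-line d m P≢x ∈-triple₁ ∈-triple₂ P∈M x∈M)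

  pencil-point-off : ∀ {D₁ D₂ D₃ M} → Pencil P D₁ D₂ D₃ → IsLine M → P ∈ M → ∃ (_∉ M)
  pencil-point-off {D₁ = D₁} {M = M} (pencil (l₁ ∷ l₂ ∷ _ ∷ []) ((D₁≢D₂ ∷ _) ∷ _) (P∈D₁ ∷ P∈D₂ ∷ _)) m P∈M
    with ≡-dec Bool._≟_ D₁ M
  ... | yes refl = point-off l₂ m P∈D₂ P∈M (D₁≢D₂ ∘ sym)
  ... | no D₁≢M  = point-off l₁ m P∈D₁ P∈M D₁≢M

  meets : ∀ {A B C L₃ L₅} → IsLine L → IsLine L₃ → IsLine L₅ → L₃ ≢ L → L₅ ≢ L → B ⊆ L₃ → C ⊆ L₅ →
          (∀ {x} → x ∈ L → x ∈ A ⊎ x ∈ B ⊎ x ∈ C) → ∃ λ x → x ∈ L × x ∈ A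
  meets {L} {A} {B} {C} l l₃ l₅ L₃≢L L₅≢L B⊆L₃ C⊆L₅ cover with line-triple l
  -- otherwise two of the three points of L would lie on L₃ or on L₅
  ... | i , j , k , (i≢j , i≢k , j≢k , _) , refl , _ = pick (cover ∈-triple₁) (cover ∈-triple₂) (cover ∈-triple₃)
    where
    twice : ∀ {D x y} → IsLine D → D ≢ L → x ≢ y → x ∈ L → y ∈ L → x ∈ D → y ∈ D → ⊥
    twice d D≢L x≢y x∈L y∈L x∈D y∈D = D≢L (same-line d l x≢y x∈D y∈D x∈L y∈L)

    pick : i ∈ A ⊎ i ∈ B ⊎ i ∈ C → j ∈ A ⊎ j ∈ B ⊎ j ∈ C → k ∈ A ⊎ k ∈ B ⊎ k ∈ C → ∃ λ x → x ∈ L × x ∈ A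
    pick (inj₁ i∈A) _ _ = i , ∈-triple₁ , i∈A
    pick _ (inj₁ j∈A) _ = j , ∈-triple₂ , j∈A
    pick _ _ (inj₁ k∈A) = k , ∈-triple₃ , k∈A
    pick (inj₂ (inj₁ i∈B)) (inj₂ (inj₁ j∈B)) _ = ⊥-elim (twice l₃ L₃≢L i≢j ∈-triple₁ ∈-triple₂ (B⊆L₃ i∈B) (B⊆L₃ j∈B))
    pick (inj₂ (inj₁ i∈B)) _ (inj₂ (inj₁ k∈B)) = ⊥-elim (twice l₃ L₃≢L i≢k ∈-triple₁ ∈-triple₃ (B⊆L₃ i∈B) (B⊆L₃ k∈B))
    pick _ (inj₂ (inj₁ j∈B)) (inj₂ (inj₁ k∈B)) = ⊥-elim (twice l₃ L₃≢L j≢k ∈-triple₂ ∈-triple₃ (B⊆L₃ j∈B) (B⊆L₃ k∈B))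
    pick (inj₂ (inj₂ i∈C)) (inj₂ (inj₂ j∈C)) _ = ⊥-elim (twice l₅ L₅≢L i≢j ∈-triple₁ ∈-triple₂ (C⊆L₅ i∈C) (C⊆L₅ j∈C))
    pick (inj₂ (inj₂ i∈C)) _ (inj₂ (inj₂ k∈C)) = ⊥-elim (twice l₅ L₅≢L i≢k ∈-triple₁ ∈-triple₃ (C⊆L₅ i∈C) (C⊆L₅ k∈C))
    pick _ (inj₂ (inj₂ j∈C)) (inj₂ (inj₂ k∈C)) = ⊥-elim (twice l₅ L₅≢L j≢k ∈-triple₂ ∈-triple₃ (C⊆L₅ j∈C) (C⊆L₅ k∈C))

module Composition {c ℓ} (F : Field c ℓ) (𝓕 : FanoPlane) (ε : MulFactor 𝓕) where
  open Field F hiding (zero; refl; sym; trans)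
  open Field F using () renaming (refl to ≈-refl; sym to ≈-sym; trans to ≈-trans)
  open import Data.Vec.Functional using (removeAt)
  open Alg 𝓕 F
  open FanoPlane 𝓕

  open import Algebra.Properties.Semiring.Sum semiring using (sum-remove; sum-cong-≋; sum-replicate-zero; ∑-distrib-+; *-distribˡ-sum)
    renaming (sum to ∑)
  open import Data.Sign.Properties using (s*s≡+; s*opposite[s]≡-)
  open import Algebra.Solver.Ring.NaturalCoefficients.Default commutativeSemiring
  open import Algebra.Properties.Ring ring using (-‿distribˡ-*; -‿distribʳ-*; x+x≈x⇒x≈0)
  open import Algebra.Properties.AbelianGroup +-abelianGroup using (⁻¹-∙-comm)
  open import Algebra.Properties.Group +-group using (⁻¹-involutive)
  open import Relation.Binary.Reasoning.Setoid setoid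

  private variable
    A B C : Point

  two : Carrier
  two = 1# + 1#

  δ : Point → Point → Carrier
  δ P Q with P ≟ Q
  ... | yes _ = 1#
  ... | no  _ = 0#

  δ-same : ∀ P → δ P P ≈ 1#
  δ-same P with P ≟ P
  ... | yes _   = ≈-refl
  ... | no P≢P = ⊥-elim (P≢P refl)

  δ-≢ : ∀ {P Q} → P ≢ Q → δ P Q ≈ 0#
  δ-≢ {P} {Q} P≢Q with P ≟ Q
  ... | yes P≡Q = ⊥-elim (P≢Q P≡Q)
  ... | no  _   = ≈-refl

  -- On Fin 7, Alg.sum and the library's ∑ unfold to the same term, so the ∑ lemmas apply to sum.
  sift : ∀ P (f : Point → Carrier) → sum (λ Q → δ P Q * f Q) ≈ f P
  sift P f = begin
    sum (λ Q → δ P Q * f Q)                          ≈⟨ sum-remove {i = P} (λ Q → δ P Q * f Q) ⟩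
    δ P P * f P + ∑ (removeAt (λ Q → δ P Q * f Q) P) ≈⟨ +-cong (≈-trans (*-congʳ (δ-same P)) (*-identityˡ _)) ∑-off-P ⟩
    f P + 0#                                         ≈⟨ +-identityʳ _ ⟩
    f P                                              ∎
    where
    ∑-off-P : ∑ (removeAt (λ Q → δ P Q * f Q) P) ≈ 0#
    ∑-off-P = ≈-trans (sum-cong-≋ (λ j → ≈-trans (*-congʳ (δ-≢ (punchInᵢ≢i P j ∘ sym))) (zeroˡ (f (punchIn P j)))))
                      (sum-replicate-zero 6)

  sift-pair : ∀ P Q (f : Point → Carrier) → sum (λ R → (δ P R + δ Q R) * f R) ≈ f P + f Q
  sift-pair P Q f = begin
    sum (λ R → (δ P R + δ Q R) * f R)              ≈⟨ sum-cong-≋ (λ R → distribʳ (f R) (δ P R) (δ Q R)) ⟩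
    sum (λ R → δ P R * f R + δ Q R * f R)          ≈⟨ ∑-distrib-+ (λ R → δ P R * f R) (λ R → δ Q R * f R) ⟩
    sum (λ R → δ P R * f R) + sum (λ R → δ Q R * f R) ≈⟨ +-cong (sift P f) (sift Q f) ⟩
    f P + f Q                                      ∎

  sum-square-pair : ∀ {U V} {v : Point → Carrier} p q → U ≢ V → (∀ W → v W ≈ δ U W * p + δ V W * q) →
                    sum (λ W → v W * v W) ≈ p * p + q * q
  sum-square-pair {U} {V} {v} p q U≢V v≈ = begin
    sum (λ W → v W * v W)                                        ≈⟨ sum-cong-≋ (λ W → ≈-trans (*-congʳ (v≈ W)) (split (δ U W) (δ V W) (v W))) ⟩
    sum (λ W → δ U W * (p * v W) + δ V W * (q * v W))             ≈⟨ ∑-distrib-+ (λ W → δ U W * (p * v W)) (λ W → δ V W * (q * v W)) ⟩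
    sum (λ W → δ U W * (p * v W)) + sum (λ W → δ V W * (q * v W)) ≈⟨ +-cong (sift U (λ W → p * v W)) (sift V (λ W → q * v W)) ⟩
    p * v U + q * v V                                            ≈⟨ +-cong (*-congˡ v-at-U) (*-congˡ v-at-V) ⟩
    p * p + q * q                                                ∎
    where
    split : ∀ x y z → (x * p + y * q) * z ≈ x * (p * z) + y * (q * z)
    split x y z = solve 5 (λ x y z p q → (x :* p :+ y :* q) :* z := x :* (p :* z) :+ y :* (q :* z)) ≈-refl x y z p q

    v-at-U : v U ≈ p
    v-at-U = begin
      v U                      ≈⟨ v≈ U ⟩
      δ U U * p + δ V U * q    ≈⟨ +-cong (*-congʳ (δ-same U)) (*-congʳ (δ-≢ (U≢V ∘ sym))) ⟩
      1# * p + 0# * q          ≈⟨ +-cong (*-identityˡ p) (zeroˡ q) ⟩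
      p + 0#                   ≈⟨ +-identityʳ p ⟩
      p                        ∎

    v-at-V : v V ≈ q
    v-at-V = begin
      v V                      ≈⟨ v≈ V ⟩
      δ U V * p + δ V V * q    ≈⟨ +-cong (*-congʳ (δ-≢ U≢V)) (*-congʳ (δ-same V)) ⟩
      0# * p + 1# * q          ≈⟨ +-cong (zeroˡ p) (*-identityˡ q) ⟩
      0# + q                   ≈⟨ +-identityˡ q ⟩
      q                        ∎

  κ : Point → Point → Point → Carrier
  κ P Q R with isSum? 𝓕 P Q R
  ... | yes _ = sgn (ε P Q)
  ... | no  _ = 0#

  private
    Σ₇-cong : ∀ {x₀ x₁ x₂ x₃ x₄ x₅ x₆ y₀ y₁ y₂ y₃ y₄ y₅ y₆} →
              x₀ ≈ y₀ → x₁ ≈ y₁ → x₂ ≈ y₂ → x₃ ≈ y₃ → x₄ ≈ y₄ → x₅ ≈ y₅ → x₆ ≈ y₆ →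
              x₀ + (x₁ + (x₂ + (x₃ + (x₄ + (x₅ + (x₆ + 0#)))))) ≈ y₀ + (y₁ + (y₂ + (y₃ + (y₄ + (y₅ + (y₆ + 0#))))))
    Σ₇-cong x₀≈y₀ x₁≈y₁ x₂≈y₂ x₃≈y₃ x₄≈y₄ x₅≈y₅ x₆≈y₆ =
      +-cong x₀≈y₀ (+-cong x₁≈y₁ (+-cong x₂≈y₂ (+-cong x₃≈y₃ (+-cong x₄≈y₄ (+-cong x₅≈y₅ (+-cong x₆≈y₆ ≈-refl))))))

    0·t : ∀ {t} → 0# ≈ 0# * t
    0·t = ≈-sym (zeroˡ _)

  -- The coefficient in a summand of a coordinate of mul is a function local to the where-block of
  -- Alg.mul and cannot be named.  Each summand lemma t_PQ therefore leaves its type to be inferred from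
  -- mul-vector, where the double sum is unfolded at the concrete points P and Q; inside it, splitting on
  -- isSum? makes both sides compute.
  module _ (a⁰ : Carrier) (a : Point → Carrier) (b⁰ : Carrier) (b : Point → Carrier) (R : Point) where
    mutual
      mul-vector : proj₂ (mul ε (a⁰ , a) (b⁰ , b)) R ≈ a⁰ * b R + a R * b⁰ + sum (λ P → sum (λ Q → κ P Q R * (a P * b Q)))
      mul-vector = +-cong ≈-refl (Σ₇-cong
          (Σ₇-cong 0·t t₀₁ t₀₂ t₀₃ t₀₄ t₀₅ t₀₆)
          (Σ₇-cong t₁₀ 0·t t₁₂ t₁₃ t₁₄ t₁₅ t₁₆)
          (Σ₇-cong t₂₀ t₂₁ 0·t t₂₃ t₂₄ t₂₅ t₂₆)
          (Σ₇-cong t₃₀ t₃₁ t₃₂ 0·t t₃₄ t₃₅ t₃₆)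
          (Σ₇-cong t₄₀ t₄₁ t₄₂ t₄₃ 0·t t₄₅ t₄₆)
          (Σ₇-cong t₅₀ t₅₁ t₅₂ t₅₃ t₅₄ 0·t t₅₆)
          (Σ₇-cong t₆₀ t₆₁ t₆₂ t₆₃ t₆₄ t₆₅ 0·t))

      t₀₁ : _
      t₀₁ with isSum? 𝓕 (# 0) (# 1) R
      ... | yes _ = ≈-refl
      ... | no  _ = 0·t
      t₀₂ : _
      t₀₂ with isSum? 𝓕 (# 0) (# 2) R
      ... | yes _ = ≈-refl
      ... | no  _ = 0·t
      t₀₃ : _
      t₀₃ with isSum? 𝓕 (# 0) (# 3) R
      ... | yes _ = ≈-refl
      ... | no  _ = 0·t
      t₀₄ : _
      t₀₄ with isSum? 𝓕 (# 0) (# 4) R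
      ... | yes _ = ≈-refl
      ... | no  _ = 0·t
      t₀₅ : _
      t₀₅ with isSum? 𝓕 (# 0) (# 5) R
      ... | yes _ = ≈-refl
      ... | no  _ = 0·t
      t₀₆ : _
      t₀₆ with isSum? 𝓕 (# 0) (# 6) R
      ... | yes _ = ≈-refl
      ... | no  _ = 0·t
      t₁₀ : _
      t₁₀ with isSum? 𝓕 (# 1) (# 0) R
      ... | yes _ = ≈-refl
      ... | no  _ = 0·t
      t₁₂ : _
      t₁₂ with isSum? 𝓕 (# 1) (# 2) R
      ... | yes _ = ≈-refl
      ... | no  _ = 0·t
      t₁₃ : _
      t₁₃ with isSum? 𝓕 (# 1) (# 3) R
      ... | yes _ = ≈-refl
      ... | no  _ = 0·t
      t₁₄ : _
      t₁₄ with isSum? 𝓕 (# 1) (# 4) R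
      ... | yes _ = ≈-refl
      ... | no  _ = 0·t
      t₁₅ : _
      t₁₅ with isSum? 𝓕 (# 1) (# 5) R
      ... | yes _ = ≈-refl
      ... | no  _ = 0·t
      t₁₆ : _
      t₁₆ with isSum? 𝓕 (# 1) (# 6) R
      ... | yes _ = ≈-refl
      ... | no  _ = 0·t
      t₂₀ : _
      t₂₀ with isSum? 𝓕 (# 2) (# 0) R
      ... | yes _ = ≈-refl
      ... | no  _ = 0·t
      t₂₁ : _
      t₂₁ with isSum? 𝓕 (# 2) (# 1) R
      ... | yes _ = ≈-refl
      ... | no  _ = 0·t
      t₂₃ : _
      t₂₃ with isSum? 𝓕 (# 2) (# 3) R
      ... | yes _ = ≈-refl
      ... | no  _ = 0·t
      t₂₄ : _
      t₂₄ with isSum? 𝓕 (# 2) (# 4) R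
      ... | yes _ = ≈-refl
      ... | no  _ = 0·t
      t₂₅ : _
      t₂₅ with isSum? 𝓕 (# 2) (# 5) R
      ... | yes _ = ≈-refl
      ... | no  _ = 0·t
      t₂₆ : _
      t₂₆ with isSum? 𝓕 (# 2) (# 6) R
      ... | yes _ = ≈-refl
      ... | no  _ = 0·t
      t₃₀ : _
      t₃₀ with isSum? 𝓕 (# 3) (# 0) R
      ... | yes _ = ≈-refl
      ... | no  _ = 0·t
      t₃₁ : _
      t₃₁ with isSum? 𝓕 (# 3) (# 1) R
      ... | yes _ = ≈-refl
      ... | no  _ = 0·t
      t₃₂ : _
      t₃₂ with isSum? 𝓕 (# 3) (# 2) R
      ... | yes _ = ≈-refl
      ... | no  _ = 0·t
      t₃₄ : _
      t₃₄ with isSum? 𝓕 (# 3) (# 4) R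
      ... | yes _ = ≈-refl
      ... | no  _ = 0·t
      t₃₅ : _
      t₃₅ with isSum? 𝓕 (# 3) (# 5) R
      ... | yes _ = ≈-refl
      ... | no  _ = 0·t
      t₃₆ : _
      t₃₆ with isSum? 𝓕 (# 3) (# 6) R
      ... | yes _ = ≈-refl
      ... | no  _ = 0·t
      t₄₀ : _
      t₄₀ with isSum? 𝓕 (# 4) (# 0) R
      ... | yes _ = ≈-refl
      ... | no  _ = 0·t
      t₄₁ : _
      t₄₁ with isSum? 𝓕 (# 4) (# 1) R
      ... | yes _ = ≈-refl
      ... | no  _ = 0·t
      t₄₂ : _
      t₄₂ with isSum? 𝓕 (# 4) (# 2) R
      ... | yes _ = ≈-refl
      ... | no  _ = 0·t
      t₄₃ : _
      t₄₃ with isSum? 𝓕 (# 4) (# 3) R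
      ... | yes _ = ≈-refl
      ... | no  _ = 0·t
      t₄₅ : _
      t₄₅ with isSum? 𝓕 (# 4) (# 5) R
      ... | yes _ = ≈-refl
      ... | no  _ = 0·t
      t₄₆ : _
      t₄₆ with isSum? 𝓕 (# 4) (# 6) R
      ... | yes _ = ≈-refl
      ... | no  _ = 0·t
      t₅₀ : _
      t₅₀ with isSum? 𝓕 (# 5) (# 0) R
      ... | yes _ = ≈-refl
      ... | no  _ = 0·t
      t₅₁ : _
      t₅₁ with isSum? 𝓕 (# 5) (# 1) R
      ... | yes _ = ≈-refl
      ... | no  _ = 0·t
      t₅₂ : _
      t₅₂ with isSum? 𝓕 (# 5) (# 2) R
      ... | yes _ = ≈-refl
      ... | no  _ = 0·t
      t₅₃ : _
      t₅₃ with isSum? 𝓕 (# 5) (# 3) R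
      ... | yes _ = ≈-refl
      ... | no  _ = 0·t
      t₅₄ : _
      t₅₄ with isSum? 𝓕 (# 5) (# 4) R
      ... | yes _ = ≈-refl
      ... | no  _ = 0·t
      t₅₆ : _
      t₅₆ with isSum? 𝓕 (# 5) (# 6) R
      ... | yes _ = ≈-refl
      ... | no  _ = 0·t
      t₆₀ : _
      t₆₀ with isSum? 𝓕 (# 6) (# 0) R
      ... | yes _ = ≈-refl
      ... | no  _ = 0·t
      t₆₁ : _
      t₆₁ with isSum? 𝓕 (# 6) (# 1) R
      ... | yes _ = ≈-refl
      ... | no  _ = 0·t
      t₆₂ : _
      t₆₂ with isSum? 𝓕 (# 6) (# 2) R
      ... | yes _ = ≈-refl
      ... | no  _ = 0·t
      t₆₃ : _
      t₆₃ with isSum? 𝓕 (# 6) (# 3) R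
      ... | yes _ = ≈-refl
      ... | no  _ = 0·t
      t₆₄ : _
      t₆₄ with isSum? 𝓕 (# 6) (# 4) R
      ... | yes _ = ≈-refl
      ... | no  _ = 0·t
      t₆₅ : _
      t₆₅ with isSum? 𝓕 (# 6) (# 5) R
      ... | yes _ = ≈-refl
      ... | no  _ = 0·t

  κ-sum : IsSum 𝓕 A B C → ∀ W → κ A B W ≈ δ C W * sgn (ε A B)
  κ-sum {A} {B} {C} s W with isSum? 𝓕 A B W | C ≟ W
  ... | yes _  | yes _   = ≈-sym (*-identityˡ _)
  ... | yes s′ | no C≢W  = ⊥-elim (C≢W (Geometry.sum-unique 𝓕 s s′))
  ... | no ¬s  | yes refl = ⊥-elim (¬s s)
  ... | no _   | no _    = ≈-sym (zeroˡ _)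

  mul-vector-sifted : ∀ a⁰ a b⁰ b R → proj₂ (mul ε (a⁰ , a) (b⁰ , b)) R ≈
                      a⁰ * b R + a R * b⁰ + sum (λ P → a P * sum (λ Q → b Q * κ P Q R))
  mul-vector-sifted a⁰ a b⁰ b R = ≈-trans (mul-vector a⁰ a b⁰ b R)
    (+-congˡ (sum-cong-≋ (λ P → ≈-trans (sum-cong-≋ (λ Q → rearrange (κ P Q R) (a P) (b Q)))
                                        (≈-sym (*-distribˡ-sum (a P) (λ Q → b Q * κ P Q R))))))
    where
    rearrange : ∀ k x y → k * (x * y) ≈ x * (y * k)
    rearrange = solve 3 (λ k x y → k :* (x :* y) := x :* (y :* k)) ≈-refl

  square-same : ∀ s → (sgn s + sgn s) * (sgn s + sgn s) ≈ two * two
  square-same Sign.+ = ≈-refl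
  square-same Sign.- = begin
    (- 1# + - 1#) * (- 1# + - 1#)   ≈⟨ *-cong (⁻¹-∙-comm 1# 1#) (⁻¹-∙-comm 1# 1#) ⟩
    - two * - two                   ≈⟨ -‿distribˡ-* two (- two) ⟨
    - (two * - two)                 ≈⟨ -‿cong (-‿distribʳ-* two two) ⟨
    - (- (two * two))               ≈⟨ ⁻¹-involutive (two * two) ⟩
    two * two                       ∎

  square-opposite : ∀ s → (sgn s + sgn (opposite s)) * (sgn s + sgn (opposite s)) ≈ 0#
  square-opposite Sign.+ = ≈-trans (*-congʳ (-‿inverseʳ 1#)) (zeroˡ _)
  square-opposite Sign.- = ≈-trans (*-congʳ (-‿inverseˡ 1#)) (zeroˡ _)

  N-pair : ∀ {A B} → A ≢ B → N (0# , λ P → δ A P + δ B P) ≈ two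
  N-pair {A} {B} A≢B = begin
    0# * 0# + sum (λ P → (δ A P + δ B P) * (δ A P + δ B P)) ≈⟨ +-cong (zeroˡ 0#) (sum-square-pair 1# 1# A≢B pair) ⟩
    0# + (1# * 1# + 1# * 1#)                               ≈⟨ +-identityˡ _ ⟩
    1# * 1# + 1# * 1#                                      ≈⟨ +-cong (*-identityˡ 1#) (*-identityˡ 1#) ⟩
    two                                                    ∎
    where
    pair : ∀ P → δ A P + δ B P ≈ δ A P * 1# + δ B P * 1#
    pair P = ≈-sym (+-cong (*-identityʳ _) (*-identityʳ _))

  N-one-plus : ∀ A → N (1# , δ A) ≈ two
  N-one-plus A = +-cong (*-identityˡ 1#) (≈-trans (sift A (δ A)) (δ-same A))

  module _ (composition : Alg.IsCompositionFactor 𝓕 F ε) where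

    norm-of-product : ∀ {x y U V} p q → N x ≈ two → N y ≈ two → proj₁ (mul ε x y) ≈ 0# → U ≢ V →
                      (∀ W → proj₂ (mul ε x y) W ≈ δ U W * p + δ V W * q) → p * p + q * q ≈ two * two
    norm-of-product {x} {y} p q Nx≈2 Ny≈2 scalar≈0 U≢V vector≈ = begin
      p * p + q * q                                   ≈⟨ +-identityˡ _ ⟨
      0# + (p * p + q * q)                            ≈⟨ +-cong (≈-trans (*-cong scalar≈0 scalar≈0) (zeroˡ 0#)) (sum-square-pair p q U≢V vector≈) ⟨
      N (mul ε x y)                                   ≈⟨ composition x y ⟩
      N x * N y                                       ≈⟨ *-cong Nx≈2 Ny≈2 ⟩
      two * two                                       ∎

  module _ (char≢2 : CharNot2 F) where

    four≉0 : ¬ two * two ≈ 0#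
    four≉0 four≈0 with inverse two char≢2
    ... | y , two*y≈1 = char≢2 (begin
      two               ≈⟨ *-identityʳ two ⟨
      two * 1#          ≈⟨ *-congˡ two*y≈1 ⟨
      two * (two * y)   ≈⟨ *-assoc two two y ⟨
      two * two * y     ≈⟨ *-congʳ four≈0 ⟩
      0# * y            ≈⟨ zeroˡ y ⟩
      0#                ∎)

    opposite-products : ∀ s s′ t t′ →
      (sgn s + sgn s′) * (sgn s + sgn s′) + (sgn t + sgn t′) * (sgn t + sgn t′) ≈ two * two →
      s · s′ ≡ opposite (t · t′)
    opposite-products s s′ t t′ squares≈four with same-or-opposite s s′ | same-or-opposite t t′
    ... | inj₁ refl | inj₁ refl = ⊥-elim (four≉0 (x+x≈x⇒x≈0 _ (≈-trans (≈-sym (+-cong (square-same s) (square-same t))) squares≈four)))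
    ... | inj₁ refl | inj₂ refl = trans (s*s≡+ s) (sym (cong opposite (s*opposite[s]≡- t)))
    ... | inj₂ refl | inj₁ refl = trans (s*opposite[s]≡- s) (sym (cong opposite (s*s≡+ t)))
    ... | inj₂ refl | inj₂ refl = ⊥-elim (four≉0 (≈-trans (≈-sym squares≈four) (≈-trans (+-cong (square-opposite s) (square-opposite t)) (+-identityˡ 0#))))

  module _ (char≢2 : CharNot2 F) (composition : Alg.IsCompositionFactor 𝓕 F ε) where

    ε-line : ∀ {A B C} → IsSum 𝓕 A B C → ε A C ≡ opposite (ε A B)
    ε-line {A} {B} {C} ABC = opposite-products char≢2 Sign.+ (ε A C) Sign.+ (ε A B)
      (norm-of-product composition (1# + sgn (ε A C)) (1# + sgn (ε A B)) (N-one-plus A) (N-pair B≢C) scalar≈0 B≢C vector≈)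
      where
      B≢C : B ≢ C
      B≢C = Geometry.sum-≢₂₃ 𝓕 ABC

      b : Point → Carrier
      b Q = δ B Q + δ C Q

      scalar≈0 : 1# * 0# - sum (λ P → δ A P * b P) ≈ 0#
      scalar≈0 = begin
        1# * 0# - sum (λ P → δ A P * b P)  ≈⟨ +-cong (zeroʳ 1#) (-‿cong (sift A b)) ⟩
        0# - (δ B A + δ C A)               ≈⟨ +-congˡ (-‿cong (+-cong (δ-≢ (Geometry.sum-≢₁₂ 𝓕 ABC ∘ sym)) (δ-≢ (Geometry.sum-≢₁₃ 𝓕 ABC ∘ sym)))) ⟩
        0# - (0# + 0#)                     ≈⟨ +-congˡ (-‿cong (+-identityˡ 0#)) ⟩
        0# - 0#                            ≈⟨ -‿inverseʳ 0# ⟩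
        0#                                 ∎

      vector≈ : ∀ W → proj₂ (mul ε (1# , δ A) (0# , b)) W ≈ δ B W * (1# + sgn (ε A C)) + δ C W * (1# + sgn (ε A B))
      vector≈ W = begin
        proj₂ (mul ε (1# , δ A) (0# , b)) W                                           ≈⟨ mul-vector-sifted 1# (δ A) 0# b W ⟩
        1# * b W + δ A W * 0# + sum (λ P → δ A P * sum (λ Q → b Q * κ P Q W))       ≈⟨ +-cong unit-part (sift A (λ P → sum (λ Q → b Q * κ P Q W))) ⟩
        (δ B W * 1# + δ C W * 1#) + sum (λ Q → b Q * κ A Q W)                         ≈⟨ +-congˡ (sift-pair B C (λ Q → κ A Q W)) ⟩
        (δ B W * 1# + δ C W * 1#) + (κ A B W + κ A C W)                               ≈⟨ +-congˡ (+-cong (κ-sum ABC W) (κ-sum (Geometry.sum-swap₂₃ 𝓕 ABC) W)) ⟩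
        (δ B W * 1# + δ C W * 1#) + (δ C W * sgn (ε A B) + δ B W * sgn (ε A C))       ≈⟨ collect (δ B W) (δ C W) 1# (sgn (ε A B)) (sgn (ε A C)) ⟩
        δ B W * (1# + sgn (ε A C)) + δ C W * (1# + sgn (ε A B))                       ∎
        where
        unit-part : 1# * b W + δ A W * 0# ≈ δ B W * 1# + δ C W * 1#
        unit-part = ≈-trans (+-cong (*-identityˡ (b W)) (zeroʳ (δ A W)))
                            (≈-trans (+-identityʳ (b W)) (≈-sym (+-cong (*-identityʳ (δ B W)) (*-identityʳ (δ C W)))))

        collect : ∀ x y o s t → (x * o + y * o) + (y * s + x * t) ≈ x * (o + t) + y * (o + s)
        collect = solve 5 (λ x y o s t → (x :* o :+ y :* o) :+ (y :* s :+ x :* t) := x :* (o :+ t) :+ y :* (o :+ s)) ≈-refl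

    ε-quadrangle : ∀ {A B C D T U} → IsSum 𝓕 A C T → IsSum 𝓕 B D T → IsSum 𝓕 A D U → IsSum 𝓕 B C U → T ≢ U →
                   ε A C · ε B D ≡ opposite (ε A D · ε B C)
    ε-quadrangle {A} {B} {C} {D} {T} {U} ACT BDT ADU BCU T≢U = opposite-products char≢2 (ε A C) (ε B D) (ε A D) (ε B C)
      (norm-of-product composition (sgn (ε A C) + sgn (ε B D)) (sgn (ε A D) + sgn (ε B C))
                       (N-pair A≢B) (N-pair C≢D) scalar≈0 T≢U vector≈)
      where
      A≢B : A ≢ B
      A≢B A≡B = T≢U (Geometry.sum-unique 𝓕 ACT (subst (λ X → IsSum 𝓕 X C U) (sym A≡B) BCU))

      C≢D : C ≢ D
      C≢D C≡D = T≢U (Geometry.sum-unique 𝓕 ACT (subst (λ X → IsSum 𝓕 A X U) (sym C≡D) ADU))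

      a b : Point → Carrier
      a P = δ A P + δ B P
      b Q = δ C Q + δ D Q

      scalar≈0 : 0# * 0# - sum (λ P → a P * b P) ≈ 0#
      scalar≈0 = begin
        0# * 0# - sum (λ P → a P * b P)              ≈⟨ +-cong (zeroˡ 0#) (-‿cong (sift-pair A B b)) ⟩
        0# - ((δ C A + δ D A) + (δ C B + δ D B))    ≈⟨ +-congˡ (-‿cong (+-cong (+-cong (δ-≢ (Geometry.sum-≢₁₂ 𝓕 ACT ∘ sym)) (δ-≢ (Geometry.sum-≢₁₂ 𝓕 ADU ∘ sym)))
                                                                              (+-cong (δ-≢ (Geometry.sum-≢₁₂ 𝓕 BCU ∘ sym)) (δ-≢ (Geometry.sum-≢₁₂ 𝓕 BDT ∘ sym))))) ⟩
        0# - ((0# + 0#) + (0# + 0#))                ≈⟨ +-congˡ (-‿cong (≈-trans (+-cong (+-identityˡ 0#) (+-identityˡ 0#)) (+-identityˡ 0#))) ⟩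
        0# - 0#                                     ≈⟨ -‿inverseʳ 0# ⟩
        0#                                          ∎

      vector≈ : ∀ W → proj₂ (mul ε (0# , a) (0# , b)) W ≈
                      δ T W * (sgn (ε A C) + sgn (ε B D)) + δ U W * (sgn (ε A D) + sgn (ε B C))
      vector≈ W = begin
        proj₂ (mul ε (0# , a) (0# , b)) W                                                       ≈⟨ mul-vector-sifted 0# a 0# b W ⟩
        0# * b W + a W * 0# + sum (λ P → a P * sum (λ Q → b Q * κ P Q W))                      ≈⟨ +-cong zero-part (sift-pair A B (λ P → sum (λ Q → b Q * κ P Q W))) ⟩
        0# + (sum (λ Q → b Q * κ A Q W) + sum (λ Q → b Q * κ B Q W))                            ≈⟨ +-identityˡ _ ⟩
        sum (λ Q → b Q * κ A Q W) + sum (λ Q → b Q * κ B Q W)                                   ≈⟨ +-cong (sift-pair C D (λ Q → κ A Q W)) (sift-pair C D (λ Q → κ B Q W)) ⟩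
        (κ A C W + κ A D W) + (κ B C W + κ B D W)                                               ≈⟨ +-cong (+-cong (κ-sum ACT W) (κ-sum ADU W)) (+-cong (κ-sum BCU W) (κ-sum BDT W)) ⟩
        (δ T W * sgn (ε A C) + δ U W * sgn (ε A D)) + (δ U W * sgn (ε B C) + δ T W * sgn (ε B D)) ≈⟨ collect (δ T W) (δ U W) (sgn (ε A C)) (sgn (ε A D)) (sgn (ε B C)) (sgn (ε B D)) ⟩
        δ T W * (sgn (ε A C) + sgn (ε B D)) + δ U W * (sgn (ε A D) + sgn (ε B C))                ∎
        where
        zero-part : 0# * b W + a W * 0# ≈ 0#
        zero-part = ≈-trans (+-cong (zeroˡ (b W)) (zeroʳ (a W))) (+-identityˡ 0#)

        collect : ∀ t u s₁ s₂ s₃ s₄ → (t * s₁ + u * s₂) + (u * s₃ + t * s₄) ≈ t * (s₁ + s₄) + u * (s₂ + s₃)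
        collect = solve 6 (λ t u s₁ s₂ s₃ s₄ → (t :* s₁ :+ u :* s₂) :+ (u :* s₃ :+ t :* s₄) := t :* (s₁ :+ s₄) :+ u :* (s₂ :+ s₃)) ≈-refl

module Deviation (𝓕 : FanoPlane) (ε : MulFactor 𝓕) (antisymmetric : IsMulFactor 𝓕 ε)
  (ε-line : ∀ {A B C} → IsSum 𝓕 A B C → ε A C ≡ opposite (ε A B))
  (ε-quadrangle : ∀ {A B C D T U} → IsSum 𝓕 A C T → IsSum 𝓕 B D T → IsSum 𝓕 A D U → IsSum 𝓕 B C U → T ≢ U →
                  ε A C · ε B D ≡ opposite (ε A D · ε B C))
  (g : Permutation′ 7) (automorphism : IsAut 𝓕 g) where

  open FanoPlane 𝓕
  open Geometry 𝓕
  open import Data.Sign.Properties using (opposite-injective; *-commutativeSemigroup; *-isCommutativeMonoid; *-assoc; *-identityʳ; *-cancelˡ-≡)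
  open import Algebra.Properties.CommutativeSemigroup *-commutativeSemigroup using (interchange)

  private variable
    A B C X Y : Point

  ∈-image⁻ : ∀ {S y} → y ∈ image 𝓕 g S → (g ⟨$⟩ˡ y) ∈ S
  ∈-image⁻ {S} {y} y∈ = lookup⇒[]= (g ⟨$⟩ˡ y) S (trans (sym (lookup∘tabulate (λ j → lookup S (g ⟨$⟩ˡ j)) y)) ([]=⇒lookup y∈))

  ∈-image⁺ : ∀ {S y} → (g ⟨$⟩ˡ y) ∈ S → y ∈ image 𝓕 g S
  ∈-image⁺ {S} {y} x∈ = lookup⇒[]= y (image 𝓕 g S) (trans (lookup∘tabulate (λ j → lookup S (g ⟨$⟩ˡ j)) y) ([]=⇒lookup x∈))

  image-triple : ∀ A B C → image 𝓕 g (triple A B C) ≡ triple (g ⟨$⟩ʳ A) (g ⟨$⟩ʳ B) (g ⟨$⟩ʳ C)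
  image-triple A B C = ⊆-antisym (λ y∈ → ∈-triple⁺ (image-member (∈-triple⁻ (∈-image⁻ y∈))))
                                 (λ y∈ → ∈-image⁺ (∈-triple⁺ (preimage-member (∈-triple⁻ y∈))))
    where
    image-member : ∀ {y} → (g ⟨$⟩ˡ y) ∈ₗ A ∷ B ∷ C ∷ [] → y ∈ₗ map (g ⟨$⟩ʳ_) (A ∷ B ∷ C ∷ [])
    image-member {y} x∈ = subst (_∈ₗ _) (inverseʳ g) (∈-map⁺ (g ⟨$⟩ʳ_) x∈)

    preimage-member : ∀ {y} → y ∈ₗ map (g ⟨$⟩ʳ_) (A ∷ B ∷ C ∷ []) → (g ⟨$⟩ˡ y) ∈ₗ A ∷ B ∷ C ∷ []
    preimage-member y∈ with ∈-map⁻ (g ⟨$⟩ʳ_) y∈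
    ... | x , x∈ , refl = subst (_∈ₗ _) (sym (inverseˡ g)) x∈

  g-injective : g ⟨$⟩ʳ X ≡ g ⟨$⟩ʳ Y → X ≡ Y
  g-injective {X} {Y} gX≡gY = trans (sym (inverseˡ g)) (trans (cong (g ⟨$⟩ˡ_) gX≡gY) (inverseˡ g))

  g-sum : IsSum 𝓕 A B C → IsSum 𝓕 (g ⟨$⟩ʳ A) (g ⟨$⟩ʳ B) (g ⟨$⟩ʳ C)
  g-sum {A} {B} {C} (A≢B , A≢C , B≢C , line) =
    A≢B ∘ g-injective , A≢C ∘ g-injective , B≢C ∘ g-injective ,
    subst IsLine (image-triple A B C) (automorphism (triple A B C) line)

  δ*-pair : Point → Point → Sign
  δ*-pair A B = ε A B · ε (g ⟨$⟩ʳ A) (g ⟨$⟩ʳ B)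

  ε-cyclic : IsSum 𝓕 A B C → ε B C ≡ ε A B
  ε-cyclic {A} {B} s = opposite-injective (trans (sym (ε-line (sum-rotate s))) (antisymmetric A B (sum-≢₁₂ s)))

  δ*-pair-sym : A ≢ B → δ*-pair B A ≡ δ*-pair A B
  δ*-pair-sym {A} {B} A≢B = trans (cong₂ _·_ (antisymmetric A B A≢B) (antisymmetric _ _ (A≢B ∘ g-injective)))
                                  (opposite-·-opposite (ε A B) _)

  δ*-pair-cyclic : IsSum 𝓕 A B C → δ*-pair B C ≡ δ*-pair A B
  δ*-pair-cyclic s = cong₂ _·_ (ε-cyclic s) (ε-cyclic (g-sum s))

  δ*-pair-cyclic² : IsSum 𝓕 A B C → δ*-pair C A ≡ δ*-pair A B
  δ*-pair-cyclic² s = trans (δ*-pair-cyclic (sum-rotate s)) (δ*-pair-cyclic s)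

  δ*-pair-line : IsSum 𝓕 A B C → X ∈ triple A B C → Y ∈ triple A B C → X ≢ Y → δ*-pair X Y ≡ δ*-pair A B
  δ*-pair-line s X∈ Y∈ X≢Y with ∈-triple⁻ X∈ | ∈-triple⁻ Y∈
  ... | here refl                 | here refl                 = ⊥-elim (X≢Y refl)
  ... | here refl                 | there (here refl)         = refl
  ... | here refl                 | there (there (here refl)) = trans (δ*-pair-sym (sum-≢₁₃ s ∘ sym)) (δ*-pair-cyclic² s)
  ... | there (here refl)         | here refl                 = δ*-pair-sym (sum-≢₁₂ s)
  ... | there (here refl)         | there (here refl)         = ⊥-elim (X≢Y refl)
  ... | there (here refl)         | there (there (here refl)) = δ*-pair-cyclic s
  ... | there (there (here refl)) | here refl                 = δ*-pair-cyclic² s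
  ... | there (there (here refl)) | there (here refl)         = trans (δ*-pair-sym (sum-≢₂₃ s)) (δ*-pair-cyclic s)
  ... | there (there (here refl)) | there (there (here refl)) = ⊥-elim (X≢Y refl)

  δ*-line : ∀ {D} → IsLine D → X ∈ D → Y ∈ D → X ≢ Y → δ* 𝓕 ε g D ≡ δ*-pair X Y
  δ*-line l X∈D Y∈D X≢Y with line-triple l
  ... | A , B , C , s , refl , points rewrite points = sym (δ*-pair-line s X∈D Y∈D X≢Y)

  δ*-quadrangle : ∀ {P R M} (q : Quadrangle P R M) → P ≢ R → let open Quadrangle q in
                  δ* 𝓕 ε g (triple a c P) · δ* 𝓕 ε g (triple b d P) ≡ δ* 𝓕 ε g (triple a d R) · δ* 𝓕 ε g (triple b c R)
  δ*-quadrangle {P} {R} q P≢R = begin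
    δ* 𝓕 ε g (triple a c P) · δ* 𝓕 ε g (triple b d P)   ≡⟨ cong₂ _·_ (δ*-line (sum-line ac-P) ∈-triple₁ ∈-triple₂ (sum-≢₁₂ ac-P))
                                                                      (δ*-line (sum-line bd-P) ∈-triple₁ ∈-triple₂ (sum-≢₁₂ bd-P)) ⟩
    (ε a c · ε′ a c) · (ε b d · ε′ b d)                 ≡⟨ interchange (ε a c) _ _ _ ⟩
    (ε a c · ε b d) · (ε′ a c · ε′ b d)                 ≡⟨ cong₂ _·_ (ε-quadrangle ac-P bd-P ad-R bc-R P≢R)
                                                                      (ε-quadrangle (g-sum ac-P) (g-sum bd-P) (g-sum ad-R) (g-sum bc-R) (P≢R ∘ g-injective)) ⟩
    opposite (ε a d · ε b c) · opposite (ε′ a d · ε′ b c) ≡⟨ opposite-·-opposite (ε a d · ε b c) _ ⟩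
    (ε a d · ε b c) · (ε′ a d · ε′ b c)                 ≡⟨ interchange (ε a d) _ _ _ ⟩
    (ε a d · ε′ a d) · (ε b c · ε′ b c)                 ≡⟨ cong₂ _·_ (δ*-line (sum-line ad-R) ∈-triple₁ ∈-triple₂ (sum-≢₁₂ ad-R))
                                                                      (δ*-line (sum-line bc-R) ∈-triple₁ ∈-triple₂ (sum-≢₁₂ bc-R)) ⟨
    δ* 𝓕 ε g (triple a d R) · δ* 𝓕 ε g (triple b c R)   ∎
    where
    open Quadrangle q
    open ≡-Reasoning

    ε′ : Point → Point → Sign
    ε′ X Y = ε (g ⟨$⟩ʳ X) (g ⟨$⟩ʳ Y)

  star : Subset 7 → Subset 7 → Subset 7 → Sign
  star D₁ D₂ D₃ = δ* 𝓕 ε g D₁ · δ* 𝓕 ε g D₂ · δ* 𝓕 ε g D₃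

  pencil-star : ∀ {P D₁ D₂ D₃ E₁ E₂ E₃} → Pencil P D₁ D₂ D₃ → Pencil P E₁ E₂ E₃ → star D₁ D₂ D₃ ≡ star E₁ E₂ E₃
  pencil-star {D₁ = D₁} {D₂} {D₃} {E₁} {E₂} {E₃} p q = begin
    star D₁ D₂ D₃                             ≡⟨ star-product D₁ D₂ D₃ ⟩
    foldr _·_ Sign.+ (map δ*ᵍ (D₁ ∷ D₂ ∷ D₃ ∷ [])) ≡⟨ foldr-commMonoid (≡.setoid Sign) *-isCommutativeMonoid (↭⇒↭ₛ (map⁺ δ*ᵍ (pencil-↭ p q))) ⟩
    foldr _·_ Sign.+ (map δ*ᵍ (E₁ ∷ E₂ ∷ E₃ ∷ [])) ≡⟨ star-product E₁ E₂ E₃ ⟨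
    star E₁ E₂ E₃                             ∎
    where
    open ≡-Reasoning

    δ*ᵍ : Subset 7 → Sign
    δ*ᵍ = δ* 𝓕 ε g

    star-product : ∀ D₁ D₂ D₃ → star D₁ D₂ D₃ ≡ foldr _·_ Sign.+ (map δ*ᵍ (D₁ ∷ D₂ ∷ D₃ ∷ []))
    star-product D₁ D₂ D₃ = trans (*-assoc (δ*ᵍ D₁) (δ*ᵍ D₂) (δ*ᵍ D₃))
                                  (cong (λ s → δ*ᵍ D₁ · (δ*ᵍ D₂ · s)) (sym (*-identityʳ (δ*ᵍ D₃))))

  pencil-star-transfer : ∀ {P R D₁ D₂ D₃ E₁ E₂ E₃} → P ≢ R → Pencil P D₁ D₂ D₃ → Pencil R E₁ E₂ E₃ →
                         star D₁ D₂ D₃ ≡ star E₁ E₂ E₃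
  pencil-star-transfer {P} {R} {D₁} {D₂} {D₃} {E₁} {E₂} {E₃} P≢R p q with sum-exists P≢R
  ... | V , PRV with pencil-point-off p (sum-line PRV) ∈-triple₁
  ...   | _ , a∉M = begin
    star D₁ D₂ D₃                                          ≡⟨ pencil-star p pencil-P ⟩
    δ*ᵍ M · δ*ᵍ (triple a c P) · δ*ᵍ (triple b d P)         ≡⟨ *-assoc (δ*ᵍ M) _ _ ⟩
    δ*ᵍ M · (δ*ᵍ (triple a c P) · δ*ᵍ (triple b d P))       ≡⟨ cong (δ*ᵍ M ·_) (δ*-quadrangle Q P≢R) ⟩
    δ*ᵍ M · (δ*ᵍ (triple a d R) · δ*ᵍ (triple b c R))       ≡⟨ *-assoc (δ*ᵍ M) _ _ ⟨
    δ*ᵍ M · δ*ᵍ (triple a d R) · δ*ᵍ (triple b c R)         ≡⟨ pencil-star pencil-R q ⟩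
    star E₁ E₂ E₃                                          ∎
    where
    open ≡-Reasoning

    M : Subset 7
    M = triple P R V

    Q : Quadrangle P R M
    Q = quadrangle PRV a∉M
    open Quadrangle Q

    δ*ᵍ : Subset 7 → Sign
    δ*ᵍ = δ* 𝓕 ε g

  pencils-agree : ∀ {P P′ D₁ D₂ D₃ E₁ E₂ E₃} → Pencil P D₁ D₂ D₃ → Pencil P′ E₁ E₂ E₃ → star D₁ D₂ D₃ ≡ star E₁ E₂ E₃
  pencils-agree {P} {P′} p q with P ≟ P′
  ... | yes refl  = pencil-star p q
  ... | no P≢P′ = pencil-star-transfer P≢P′ p q

  pencils-share-line : ∀ {P P′ L A B C D} → Pencil P L A B → Pencil P′ L C D →
                       δ* 𝓕 ε g A · δ* 𝓕 ε g B ≡ δ* 𝓕 ε g C · δ* 𝓕 ε g D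
  pencils-share-line {L = L} p q = *-cancelˡ-≡ (δ* 𝓕 ε g L) _ _
    (trans (sym (*-assoc (δ* 𝓕 ε g L) _ _)) (trans (pencils-agree p q) (*-assoc (δ* 𝓕 ε g L) _ _)))

  paired-products : ∀ {L L₁ L₂ L₃ L₄ L₅ L₆} →
    All IsLine (L ∷ L₁ ∷ L₂ ∷ L₃ ∷ L₄ ∷ L₅ ∷ L₆ ∷ []) → Unique (L ∷ L₁ ∷ L₂ ∷ L₃ ∷ L₄ ∷ L₅ ∷ L₆ ∷ []) →
    L ≡ (L₁ ∩ L₂) ∪ (L₃ ∩ L₄) ∪ (L₅ ∩ L₆) →
    (δ* 𝓕 ε g L₁ · δ* 𝓕 ε g L₂ ≡ δ* 𝓕 ε g L₃ · δ* 𝓕 ε g L₄) × (δ* 𝓕 ε g L₃ · δ* 𝓕 ε g L₄ ≡ δ* 𝓕 ε g L₅ · δ* 𝓕 ε g L₆)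
  paired-products {L} {L₁} {L₂} {L₃} {L₄} {L₅} {L₆} (l ∷ l₁ ∷ l₂ ∷ l₃ ∷ l₄ ∷ l₅ ∷ l₆ ∷ [])
    ((L≢L₁ ∷ L≢L₂ ∷ L≢L₃ ∷ L≢L₄ ∷ L≢L₅ ∷ L≢L₆ ∷ []) ∷ (L₁≢L₂ ∷ _) ∷ _ ∷ (L₃≢L₄ ∷ _) ∷ _ ∷ (L₅≢L₆ ∷ []) ∷ [] ∷ []) L≡ =
    pencils-share-line (proj₂ pencil₁₂) (proj₂ pencil₃₄) , pencils-share-line (proj₂ pencil₃₄) (proj₂ pencil₅₆)
    where
    cover : ∀ {x} → x ∈ L → x ∈ L₁ ∩ L₂ ⊎ x ∈ L₃ ∩ L₄ ⊎ x ∈ L₅ ∩ L₆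
    cover x∈L with x∈p∪q⁻ (L₁ ∩ L₂) _ (subst (_ ∈_) L≡ x∈L)
    ... | inj₁ x∈₁₂   = inj₁ x∈₁₂
    ... | inj₂ x∈₃₄₅₆ = inj₂ (x∈p∪q⁻ (L₃ ∩ L₄) (L₅ ∩ L₆) x∈₃₄₅₆)

    pencil-at : ∀ {A B} → (∃ λ x → x ∈ L × x ∈ A ∩ B) → IsLine A → IsLine B → L ≢ A → L ≢ B → A ≢ B →
                Σ[ x ∈ Point ] Pencil x L A B
    pencil-at {A} {B} (x , x∈L , x∈A∩B) a b L≢A L≢B A≢B with x∈p∩q⁻ A B x∈A∩B
    ... | x∈A , x∈B = x , pencil (l ∷ a ∷ b ∷ []) ((L≢A ∷ L≢B ∷ []) ∷ (A≢B ∷ []) ∷ [] ∷ []) (x∈L ∷ x∈A ∷ x∈B ∷ [])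

    pencil₁₂ : Σ[ x ∈ Point ] Pencil x L L₁ L₂
    pencil₁₂ = pencil-at (meets l l₃ l₅ (L≢L₃ ∘ sym) (L≢L₅ ∘ sym) (p∩q⊆p L₃ L₄) (p∩q⊆p L₅ L₆) cover)
                         l₁ l₂ L≢L₁ L≢L₂ L₁≢L₂

    pencil₃₄ : Σ[ x ∈ Point ] Pencil x L L₃ L₄
    pencil₃₄ = pencil-at (meets l l₁ l₅ (L≢L₁ ∘ sym) (L≢L₅ ∘ sym) (p∩q⊆p L₁ L₂) (p∩q⊆p L₅ L₆)
                                (Sum.[ inj₂ ∘ inj₁ , Sum.[ inj₁ , inj₂ ∘ inj₂ ] ] ∘ cover))
                         l₃ l₄ L≢L₃ L≢L₄ L₃≢L₄

    pencil₅₆ : Σ[ x ∈ Point ] Pencil x L L₅ L₆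
    pencil₅₆ = pencil-at (meets l l₁ l₃ (L≢L₁ ∘ sym) (L≢L₃ ∘ sym) (p∩q⊆p L₁ L₂) (p∩q⊆p L₃ L₄)
                                (Sum.[ inj₂ ∘ inj₁ , Sum.[ inj₂ ∘ inj₂ , inj₁ ] ] ∘ cover))
                         l₅ l₆ L≢L₅ L≢L₆ L₅≢L₆

proposition2p29 :
    ∀ {c ℓ} (F : Field c ℓ) → CharNot2 F →
    (𝓕 : FanoPlane) (ε : MulFactor 𝓕) → IsMulFactor 𝓕 ε →
    Alg.IsCompositionFactor 𝓕 F ε →
    (g : Permutation′ 7) → IsAut 𝓕 g →
    -- (1)
    (∀ (L L₁ L₂ L₃ L₄ L₅ L₆ : Subset 7) →
       All (FanoPlane.IsLine 𝓕) (L ∷ L₁ ∷ L₂ ∷ L₃ ∷ L₄ ∷ L₅ ∷ L₆ ∷ []) →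
       Unique (L ∷ L₁ ∷ L₂ ∷ L₃ ∷ L₄ ∷ L₅ ∷ L₆ ∷ []) →
       L ≡ (L₁ ∩ L₂) ∪ (L₃ ∩ L₄) ∪ (L₅ ∩ L₆) →
       (δ* 𝓕 ε g L₁ · δ* 𝓕 ε g L₂ ≡ δ* 𝓕 ε g L₃ · δ* 𝓕 ε g L₄)
       × (δ* 𝓕 ε g L₃ · δ* 𝓕 ε g L₄ ≡ δ* 𝓕 ε g L₅ · δ* 𝓕 ε g L₆))
    ×
    -- (2)
    (∀ (P P′ : Point) (D₁ D₂ D₃ D′₁ D′₂ D′₃ : Subset 7) →
       All (FanoPlane.IsLine 𝓕) (D₁ ∷ D₂ ∷ D₃ ∷ D′₁ ∷ D′₂ ∷ D′₃ ∷ []) →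
       Unique (D₁ ∷ D₂ ∷ D₃ ∷ []) → Unique (D′₁ ∷ D′₂ ∷ D′₃ ∷ []) →
       P ∈ D₁ → P ∈ D₂ → P ∈ D₃ → P′ ∈ D′₁ → P′ ∈ D′₂ → P′ ∈ D′₃ →
       δ* 𝓕 ε g D₁ · δ* 𝓕 ε g D₂ · δ* 𝓕 ε g D₃
         ≡ δ* 𝓕 ε g D′₁ · δ* 𝓕 ε g D′₂ · δ* 𝓕 ε g D′₃)
proposition2p29 F char≢2 𝓕 ε antisymmetric composition g automorphism =
  (λ _ _ _ _ _ _ _ → paired-products) ,
  λ { _ _ _ _ _ _ _ _ (l₁ ∷ l₂ ∷ l₃ ∷ l′₁ ∷ l′₂ ∷ l′₃ ∷ []) distinct distinct′ P∈D₁ P∈D₂ P∈D₃ P′∈D′₁ P′∈D′₂ P′∈D′₃ →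
      pencils-agree (pencil (l₁ ∷ l₂ ∷ l₃ ∷ []) distinct (P∈D₁ ∷ P∈D₂ ∷ P∈D₃ ∷ []))
                    (pencil (l′₁ ∷ l′₂ ∷ l′₃ ∷ []) distinct′ (P′∈D′₁ ∷ P′∈D′₂ ∷ P′∈D′₃ ∷ [])) }
  where
  open Geometry 𝓕 using (pencil)
  open Composition F 𝓕 ε using (ε-line; ε-quadrangle)
  open Deviation 𝓕 ε antisymmetric (ε-line char≢2 composition) (ε-quadrangle char≢2 composition) g automorphism
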